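{- If $H$ is a connected elder graph, then there exists an outbranching $T\subseteq H$ such that $(H,T)$ is a vineyard.
   Context: Directed graphs have no loops, parallel edges, or oppositely directed pairs of edges. A directed graph is connected if its underlying undirected graph is connected. Two vertices $u,v$ form a fork if they are distinct, non-adjacent, and there is a vertex $w$ with $(u,w),(v,w)$ edges. An elder graph is a directed graph with no fork. An outbranching is a directed tree with all edges directed away from its root. A pair $(H,T)$ is a vineyard if $T$ is an outbranching, $H$ is a directed graph with $V(H)=V(T)$ and $T\subseteq H$, and for every edge $(t_1,t_2)\in E(H)$ there is a directed path in $T$ either from $t_1$ to $t_2$ or from $t_2$ to $t_1$. -}

module Defs where

open import Data.Nat using (ℕ; _≤_; _<_)
open import Data.Fin using (Fin)
open import Data.Bool using (Bool; true; false)
open import Data.List using (List; []; _∷_; _++_; [_]; length)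
open import Data.List.Relation.Unary.Unique.Propositional using (Unique)
open import Data.Product using (Σ; ∃; _×_)
open import Data.Sum using (_⊎_)
open import Relation.Nullary using (¬_)
open import Relation.Binary.PropositionalEquality using (_≡_; _≢_)

-- A (finite) directed graph on vertex set Fin n, given by its adjacency
-- relation.  A relation cannot have parallel edges; we additionally forbid
-- loops and oppositely directed pairs of edges.
record Digraph (n : ℕ) : Set where
  field
    adj   : Fin n → Fin n → Bool
    loopless : ∀ v → adj v v ≡ false
    asym  : ∀ u v → adj u v ≡ true → adj v u ≡ false
open Digraph public

Edge : ∀ {n} → Digraph n → Fin n → Fin n → Set
Edge G u v = adj G u v ≡ true

Adjacent : ∀ {n} → Digraph n → Fin n → Fin n → Set
Adjacent G u v = Edge G u v ⊎ Edge G v u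

data UWalk {n} (G : Digraph n) : Fin n → Fin n → Set where
  here : ∀ {u} → UWalk G u u
  step : ∀ {u w v} → Adjacent G u w → UWalk G w v → UWalk G u v

-- directed walks (in a graph, a directed walk from a to b exists iff a
-- directed path from a to b exists)
data DPath {n} (G : Digraph n) : Fin n → Fin n → Set where
  here : ∀ {u} → DPath G u u
  step : ∀ {u w v} → Edge G u w → DPath G w v → DPath G u v

Connected : ∀ {n} → Digraph n → Set
Connected {n} G = (0 < n) × (∀ u v → UWalk G u v)

Fork : ∀ {n} → Digraph n → Fin n → Fin n → Set
Fork G u v = (u ≢ v) × (¬ Adjacent G u v) × ∃ λ w → Edge G u w × Edge G v w

Elder : ∀ {n} → Digraph n → Set
Elder G = ∀ u v → ¬ Fork G u v

data Chain {n} (G : Digraph n) : List (Fin n) → Set where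
  single : ∀ {v} → Chain G [ v ]
  cons   : ∀ {u v vs} → Adjacent G u v → Chain G (v ∷ vs) → Chain G (u ∷ v ∷ vs)

-- a cycle (with at least 3 distinct vertices) in the underlying undirected graph
UCycle : ∀ {n} → Digraph n → Set
UCycle {n} G = Σ (Fin n) λ x → Σ (Fin n) λ y → Σ (List (Fin n)) λ mid →
  (1 ≤ length mid) × Unique (x ∷ mid ++ [ y ]) × Chain G (x ∷ mid ++ [ y ])
  × Adjacent G y x

DirectedTree : ∀ {n} → Digraph n → Set
DirectedTree G = Connected G × ¬ UCycle G

-- outbranching with root r: a directed tree all of whose edges are directed
-- away from r, i.e. every vertex is reachable from r by a directed path
Outbranching : ∀ {n} → Digraph n → Set
Outbranching {n} T = DirectedTree T × Σ (Fin n) λ r → ∀ v → DPath T r v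

_⊆ᴳ_ : ∀ {n} → Digraph n → Digraph n → Set
T ⊆ᴳ H = ∀ u v → Edge T u v → Edge H u v

Vineyard : ∀ {n} → Digraph n → Digraph n → Set
Vineyard H T = Outbranching T × (T ⊆ᴳ H) ×
  (∀ t₁ t₂ → Edge H t₁ t₂ → DPath T t₁ t₂ ⊎ DPath T t₂ t₁)

-- In an elder graph any two in-neighbours of a vertex are adjacent. Hence if an edge x → y enters the set S
-- of vertices reachable from c (inside some vertex set Y), walking back along a path from c to y shows x → c;
-- a candidate reaching x then has a strictly larger reach set. So a candidate whose reach set is maximal has a
-- reach set that no edge enters; with all vertices as candidates and H connected, this yields a root r
-- reaching every vertex. The tree is built by recursion on the vertex set X: an out-neighbour c of r chosen
-- in this way within X − r has a reach set P that is entered only from r and left only towards r, so trees on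
-- P (rooted at c) and on X ∖ P (rooted at r), joined by the edge r → c, keep every edge of H ancestral.
module Submission where

open import Defs
open import Data.Nat using (ℕ; zero; suc; _<_)
open import Data.Nat.Properties
  using (<-irrefl; <-asym; <-trans; ≤-reflexive; ≤-pred; ≤⇒≯; 0≢1+n; suc-injective)
open import Data.Fin using (Fin; fromℕ<)
open import Data.Vec using (_∷_; here; there)
open import Data.Fin.Properties using (_≟_; any?)
open import Data.Fin.Subset.Induction using (Acc; acc; ⊂-wellFounded; ⊃-wellFounded)
open import Data.Fin.Subset
  using (Subset; inside; outside; ⊤; _∈_; _∉_; _⊆_; _⊂_; _⊃_; _∪_; _─_; _-_; ⁅_⁆)
open import Data.Fin.Subset.Properties
  using ( _∈?_; nonempty?; ∈⊤; p─q⊆p; p⊆p∪q; x∈p∪q⁺; x∈p∪q⁻; x∈⁅x⁆; x∈⁅y⁆⇒x≡y; x∉⁅y⁆⇒x≢y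
        ; x∈p∧x∉q⇒x∈p─q; x∈p∧x≢y⇒x∈p-y)
open import Data.Bool using (true)
open import Data.Bool.Properties using (¬-not; T-≡) renaming (_≟_ to _≟ᵇ_)
open import Data.List using (List; []; _∷_; _++_; [_])
open import Data.List.Membership.Propositional using () renaming (_∈_ to _∈ₗ_)
open import Data.List.Membership.Propositional.Properties using (∈-++⁺ˡ; ∈-++⁺ʳ)
open import Data.List.Relation.Unary.All as All using (All; []; _∷_)
open import Data.List.Relation.Unary.Any using (here; there)
open import Data.List.Relation.Unary.AllPairs using (_∷_)
open import Data.List.Relation.Unary.Unique.Propositional using (Unique)
open import Data.Product using (Σ; ∃₂; _×_; _,_; proj₁; proj₂; map₂)
import Data.Sum as Sum
open import Data.Sum using (_⊎_; inj₁; inj₂; [_,_]′; reduce)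
open import Function using (_∘_; id)
open import Function.Bundles using (Equivalence)
open import Relation.Nullary using (¬_; Dec; yes; no; contradiction)
open import Relation.Nullary.Decidable using (isYes; decidable-stable; toWitness; fromWitness; ¬?; _×-dec_)
open import Relation.Binary.PropositionalEquality using (_≡_; _≢_; refl; sym; ≢-sym; trans; cong; subst)

private
  variable
    n : ℕ

x∈p─q⇒x∉q : ∀ {x : Fin n} (p q : Subset n) → x ∈ p ─ q → x ∉ q
x∈p─q⇒x∉q (_ ∷ p) (outside ∷ q) (there x∈p─q) (there x∈q) = x∈p─q⇒x∉q p q x∈p─q x∈q
x∈p─q⇒x∉q (_ ∷ p) (inside ∷ q) () here
x∈p─q⇒x∉q (_ ∷ p) (inside ∷ q) (there x∈p─q) (there x∈q) = x∈p─q⇒x∉q p q x∈p─q x∈q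

x∈p─q⁻ : ∀ {x : Fin n} (p q : Subset n) → x ∈ p ─ q → x ∈ p × x ∉ q
x∈p─q⁻ p q x∈p─q = p─q⊆p p q x∈p─q , x∈p─q⇒x∉q p q x∈p─q

x∈p-y⁻ : ∀ {x : Fin n} (p : Subset n) y → x ∈ p - y → x ∈ p × x ≢ y
x∈p-y⁻ p y x∈p-y = map₂ x∉⁅y⁆⇒x≢y (x∈p─q⁻ p ⁅ y ⁆ x∈p-y)

p⊂p∪⁅x⁆ : ∀ {p : Subset n} {x} → x ∉ p → p ⊂ p ∪ ⁅ x ⁆
p⊂p∪⁅x⁆ {x = x} x∉p = p⊆p∪q ⁅ x ⁆ , x , x∈p∪q⁺ (inj₂ (x∈⁅x⁆ x)) , x∉p

last : ∀ {A : Set} → A → List A → A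
last x []       = x
last _ (y ∷ ys) = last y ys

last-∈ : ∀ {A : Set} (x : A) xs → last x xs ∈ₗ x ∷ xs
last-∈ x []       = here refl
last-∈ _ (y ∷ ys) = there (last-∈ y ys)

-- The parent-pointer chain from v reaches u without stepping off the root r, whose parent is junk.
data Ancestor (parent : Fin n → Fin n) (r u : Fin n) : Fin n → Set where
  here : Ancestor parent r u u
  step : ∀ {v} → v ≢ r → Ancestor parent r u (parent v) → Ancestor parent r u v

ancestor-trans : ∀ {parent : Fin n → Fin n} {r u w v} →
  Ancestor parent r u w → Ancestor parent r w v → Ancestor parent r u v
ancestor-trans a here = a
ancestor-trans a (step v≢r b) = step v≢r (ancestor-trans a b)

ancestor-map : ∀ {S : Subset n} {parent parent′ : Fin n → Fin n} {r r′ u v} →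
  (∀ {w} → w ∈ S → w ≢ r → w ≢ r′ × parent′ w ≡ parent w × parent w ∈ S) →
  v ∈ S → Ancestor parent r u v → Ancestor parent′ r′ u v
ancestor-map agree v∈S here = here
ancestor-map agree v∈S (step v≢r a) with agree v∈S v≢r
... | v≢r′ , parent′≡parent , parent∈S =
  step v≢r′ (subst (Ancestor _ _ _) (sym parent′≡parent) (ancestor-map agree parent∈S a))

module ParentGraph {n} (r : Fin n) (parent : Fin n → Fin n) (depth : Fin n → ℕ)
  (depth-parent : ∀ {v} → v ≢ r → depth v ≡ suc (depth (parent v))) where

  TreeEdge : Fin n → Fin n → Set
  TreeEdge u v = v ≢ r × parent v ≡ u

  treeEdge? : ∀ u v → Dec (TreeEdge u v)
  treeEdge? u v = ¬? (v ≟ r) ×-dec (parent v ≟ u)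

  treeEdge-depth : ∀ {u v} → TreeEdge u v → depth v ≡ suc (depth u)
  treeEdge-depth (v≢r , refl) = depth-parent v≢r

  treeEdge-deepens : ∀ {u v} → TreeEdge u v → depth u < depth v
  treeEdge-deepens = ≤-reflexive ∘ sym ∘ treeEdge-depth

  edge⇒treeEdge : ∀ {u v} → isYes (treeEdge? u v) ≡ true → TreeEdge u v
  edge⇒treeEdge {u} {v} = toWitness {a? = treeEdge? u v} ∘ Equivalence.from T-≡

  graph : Digraph n
  adj      graph u v   = isYes (treeEdge? u v)
  loopless graph v     = ¬-not (<-irrefl refl ∘ treeEdge-deepens ∘ edge⇒treeEdge)
  asym     graph u v e = ¬-not λ e′ →
    <-asym (treeEdge-deepens (edge⇒treeEdge e)) (treeEdge-deepens (edge⇒treeEdge e′))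

  treeEdge⇒edge : ∀ {u v} → TreeEdge u v → Edge graph u v
  treeEdge⇒edge t = Equivalence.to T-≡ (fromWitness t)

  ancestor⇒path : ∀ {u w v} → Ancestor parent r u w → DPath graph w v → DPath graph u v
  ancestor⇒path here p = p
  ancestor⇒path (step w≢r a) p = ancestor⇒path a (step (treeEdge⇒edge (w≢r , refl)) p)

  descend : ∀ {u w v} → Ancestor parent r u w → UWalk graph w v → UWalk graph u v
  descend here p = p
  descend (step w≢r a) p = descend a (step (inj₁ (treeEdge⇒edge (w≢r , refl))) p)

  ascend : ∀ {u w v} → Ancestor parent r w u → UWalk graph w v → UWalk graph u v
  ascend here p = p
  ascend (step u≢r a) p = step (inj₂ (treeEdge⇒edge (u≢r , refl))) (ascend a p)

  descent-continues : ∀ {s m rest} → Unique (s ∷ m ∷ rest) → Chain graph (m ∷ rest) →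
    TreeEdge s m → All (λ v → depth s < depth v) (m ∷ rest)
  descent-continues _ single s→m = treeEdge-deepens s→m ∷ []
  descent-continues ((_ ∷ s≢t ∷ _) ∷ unique) (cons (inj₁ m→t) chain) s→m =
    treeEdge-deepens s→m ∷ All.map (<-trans (treeEdge-deepens s→m))
                                    (descent-continues unique chain (edge⇒treeEdge m→t))
  descent-continues ((_ ∷ s≢t ∷ _) ∷ _) (cons (inj₂ t→m) _) s→m =
    contradiction (trans (sym (proj₂ s→m)) (proj₂ (edge⇒treeEdge t→m))) s≢t

  ends-descending-or-above : ∀ {s e} mid → Unique (s ∷ mid ++ [ e ]) → Chain graph (s ∷ mid ++ [ e ]) →
    parent e ≡ last s mid ⊎ depth e < depth s
  ends-descending-or-above [] _ (cons (inj₁ s→e) single) = inj₁ (proj₂ (edge⇒treeEdge s→e))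
  ends-descending-or-above [] _ (cons (inj₂ e→s) single) = inj₂ (treeEdge-deepens (edge⇒treeEdge e→s))
  ends-descending-or-above {s} {e} (m ∷ ms) unique@(_ ∷ unique′) (cons s–m chain)
    with ends-descending-or-above ms unique′ chain | s–m
  ... | inj₁ entered | _ = inj₁ entered
  ... | inj₂ e<m | inj₂ m→s = inj₂ (<-trans e<m (treeEdge-deepens (edge⇒treeEdge m→s)))
  ... | inj₂ e<m | inj₁ s→m =
    contradiction (All.lookup (descent-continues unique chain (edge⇒treeEdge s→m))
                              (∈-++⁺ʳ (m ∷ ms) (here refl)))
                  (≤⇒≯ (≤-pred (subst (depth e <_) (treeEdge-depth (edge⇒treeEdge s→m)) e<m)))

  acyclic : ¬ UCycle graph
  acyclic (_ , _ , [] , () , _)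
  acyclic (x , y , m ∷ ms , _ , unique@(x≢ ∷ (m≢ ∷ _)) , chain@(cons x–m chain′) , inj₁ y→x)
    with x–m
  ... | inj₁ x→m = <-asym (treeEdge-deepens (edge⇒treeEdge y→x))
                         (All.lookup (descent-continues unique chain′ (edge⇒treeEdge x→m))
                                     (∈-++⁺ʳ (m ∷ ms) (here refl)))
  ... | inj₂ m→x = All.lookup m≢ (∈-++⁺ʳ ms (here refl))
                     (trans (sym (proj₂ (edge⇒treeEdge m→x))) (proj₂ (edge⇒treeEdge y→x)))
  acyclic (x , y , m ∷ ms , _ , unique@(x≢ ∷ _) , chain , inj₂ x→y)
    with ends-descending-or-above (m ∷ ms) unique chain
  ... | inj₁ entered =
    All.lookup x≢ (∈-++⁺ˡ (last-∈ m ms)) (trans (sym (proj₂ (edge⇒treeEdge x→y))) entered)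
  ... | inj₂ y<x = <-asym y<x (treeEdge-deepens (edge⇒treeEdge x→y))

  outbranching : 0 < n → (∀ v → Ancestor parent r r v) → Outbranching graph
  outbranching n>0 rooted =
    ((n>0 , λ u v → ascend (rooted u) (descend (rooted v) here)) , acyclic) ,
    r , λ v → ancestor⇒path (rooted v) here

module ElderGraph {n} (H : Digraph n) (elder : Elder H) where

  edge? : ∀ u v → Dec (Edge H u v)
  edge? u v = adj H u v ≟ᵇ true

  edge-irreflexive : ∀ {u v} → Edge H u v → u ≢ v
  edge-irreflexive {u} u→u refl = contradiction (trans (sym u→u) (loopless H u)) λ ()

  in-neighbours-adjacent : ∀ {a b w} → Edge H a w → Edge H b w → a ≢ b → Adjacent H a b
  in-neighbours-adjacent {a} {b} a→w b→w a≢b with edge? a b | edge? b a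
  ... | yes a→b | _       = inj₁ a→b
  ... | no _    | yes b→a = inj₂ b→a
  ... | no ¬a→b | no ¬b→a = contradiction (a≢b , [ ¬a→b , ¬b→a ]′ , _ , a→w , b→w) (elder a b)

  data Reach (Y : Subset n) : Fin n → Fin n → Set where
    here : ∀ {u} → Reach Y u u
    step : ∀ {u w v} → Edge H u w → w ∈ Y → Reach Y w v → Reach Y u v

  reach-++ : ∀ {Y u w v} → Reach Y u w → Reach Y w v → Reach Y u v
  reach-++ here q = q
  reach-++ (step e w∈Y p) q = step e w∈Y (reach-++ p q)

  reach-mono : ∀ {Y Z u v} → Y ⊆ Z → Reach Y u v → Reach Z u v
  reach-mono Y⊆Z here = here
  reach-mono Y⊆Z (step e w∈Y p) = step e (Y⊆Z w∈Y) (reach-mono Y⊆Z p)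

  ForwardClosed : Subset n → Subset n → Set
  ForwardClosed Y S = ∀ {u v} → u ∈ S → v ∈ Y → Edge H u v → v ∈ S

  BackwardClosed : Subset n → Subset n → Set
  BackwardClosed Y S = ∀ {u v} → u ∈ Y → v ∈ S → Edge H u v → u ∈ S

  reach-closed : ∀ {Y S u v} → ForwardClosed Y S → u ∈ S → Reach Y u v → v ∈ S
  reach-closed closed u∈S here = u∈S
  reach-closed closed u∈S (step e w∈Y p) = reach-closed closed (closed u∈S w∈Y e) p

  reach-inside : ∀ {Y S u v} → ForwardClosed Y S → u ∈ S → Reach Y u v → Reach S u v
  reach-inside closed u∈S here = here
  reach-inside closed u∈S (step e w∈Y p) = step e w∈S (reach-inside closed w∈S p)
    where w∈S = closed u∈S w∈Y e

  reach-outside : ∀ {Y S u v} → ForwardClosed Y S → v ∉ S → Reach Y u v → Reach (Y ─ S) u v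
  reach-outside closed v∉S here = here
  reach-outside closed v∉S (step e w∈Y p) =
    step e (x∈p∧x∉q⇒x∈p─q w∈Y λ w∈S → v∉S (reach-closed closed w∈S p)) (reach-outside closed v∉S p)

  reach-avoiding : ∀ {Y w v} u → Reach Y w v → Reach (Y - u) w v ⊎ Reach (Y - u) u v
  reach-avoiding u here = inj₁ here
  reach-avoiding u (step {w = x} e x∈Y p) with reach-avoiding u p | x ≟ u
  ... | inj₂ q | _        = inj₂ q
  ... | inj₁ q | yes refl = inj₂ q
  ... | inj₁ q | no x≢u   = inj₁ (step e (x∈p∧x≢y⇒x∈p-y x∈Y x≢u) q)

  reach-avoiding-source : ∀ {Y u v} → Reach Y u v → Reach (Y - u) u v
  reach-avoiding-source {u = u} = reduce ∘ reach-avoiding u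

  out-neighbour-reaching : ∀ {Y u v} → Reach Y u v → u ≢ v →
    Σ (Fin n) λ c → (Edge H u c × c ∈ Y - u) × Reach (Y - u) c v
  out-neighbour-reaching p u≢v with reach-avoiding-source p
  ... | here = contradiction refl u≢v
  ... | step u→c c∈Y-u q = _ , (u→c , c∈Y-u) , q

  record ReachSet (Y : Subset n) (c : Fin n) : Set where
    field
      members        : Subset n
      source∈        : c ∈ members
      members⊆Y      : members ⊆ Y
      reachable      : ∀ {v} → v ∈ members → Reach Y c v
      forward-closed : ForwardClosed Y members

    reach⇒member : ∀ {v} → Reach Y c v → v ∈ members
    reach⇒member = reach-closed forward-closed source∈

  open ReachSet

  Crossing : Subset n → Subset n → Set
  Crossing A B = ∃₂ λ u v → u ∈ A × v ∈ B × Edge H u v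

  crossing? : ∀ A B → Dec (Crossing A B)
  crossing? A B = any? λ u → any? λ v → u ∈? A ×-dec v ∈? B ×-dec edge? u v

  reachSet : ∀ {Y c} → c ∈ Y → ReachSet Y c
  reachSet {Y} {c} c∈Y = grow ⁅ c ⁆ (⊃-wellFounded _) (x∈⁅x⁆ c)
    (λ x∈⁅c⁆ → subst (_∈ Y) (sym (x∈⁅y⁆⇒x≡y c x∈⁅c⁆)) c∈Y)
    (λ x∈⁅c⁆ → subst (Reach Y c) (sym (x∈⁅y⁆⇒x≡y c x∈⁅c⁆)) here)
    where
    grow : ∀ S → Acc _⊃_ S → c ∈ S → S ⊆ Y → (∀ {v} → v ∈ S → Reach Y c v) → ReachSet Y c
    grow S (acc larger) c∈S S⊆Y reach with crossing? S (Y ─ S)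
    ... | no ¬crossing = record
      { members = S ; source∈ = c∈S ; members⊆Y = S⊆Y ; reachable = reach ; forward-closed = closed }
      where
      closed : ForwardClosed Y S
      closed {u} {v} u∈S v∈Y u→v with v ∈? S
      ... | yes v∈S = v∈S
      ... | no v∉S  = contradiction (u , v , u∈S , x∈p∧x∉q⇒x∈p─q v∈Y v∉S , u→v) ¬crossing
    ... | yes (u , v , u∈S , v∈Y─S , u→v) =
      grow (S ∪ ⁅ v ⁆) (larger (p⊂p∪⁅x⁆ v∉S)) (p⊆p∪q ⁅ v ⁆ c∈S) S∪v⊆Y reach′
      where
      v∈Y = proj₁ (x∈p─q⁻ Y S v∈Y─S)
      v∉S = proj₂ (x∈p─q⁻ Y S v∈Y─S)
      S∪v⊆Y : S ∪ ⁅ v ⁆ ⊆ Y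
      S∪v⊆Y x∈ with x∈p∪q⁻ S ⁅ v ⁆ x∈
      ... | inj₁ x∈S = S⊆Y x∈S
      ... | inj₂ x∈⁅v⁆ rewrite x∈⁅y⁆⇒x≡y v x∈⁅v⁆ = v∈Y
      reach′ : ∀ {x} → x ∈ S ∪ ⁅ v ⁆ → Reach Y c x
      reach′ x∈ with x∈p∪q⁻ S ⁅ v ⁆ x∈
      ... | inj₁ x∈S = reach x∈S
      ... | inj₂ x∈⁅v⁆ rewrite x∈⁅y⁆⇒x≡y v x∈⁅v⁆ =
        reach-++ (reach u∈S) (step u→v v∈Y here)

  -- The elder property, applied along a walk from u to y, moves the head of x → y back to u.
  edge-to-source : ∀ {Y S x u y} → ForwardClosed Y S → x ∈ Y → x ∉ S → u ∈ S →
    Reach Y u y → Edge H x y → Edge H x u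
  edge-to-source closed x∈Y x∉S u∈S here x→y = x→y
  edge-to-source closed x∈Y x∉S u∈S (step u→w w∈Y p) x→y
    with in-neighbours-adjacent u→w (edge-to-source closed x∈Y x∉S (closed u∈S w∈Y u→w) p x→y)
                                (λ u≡x → x∉S (subst (_∈ _) u≡x u∈S))
  ... | inj₁ u→x = contradiction (closed u∈S x∈Y u→x) x∉S
  ... | inj₂ x→u = x→u

  record GoodSource (Y : Subset n) (Candidate : Fin n → Set) : Set where
    field
      source          : Fin n
      candidate       : Candidate source
      reachSetOf      : ReachSet Y source
      backward-closed : BackwardClosed Y (members reachSetOf)

  -- An edge entering the reach set of c points at c, so a candidate reaching its tail has a larger reach set.
  goodSource : ∀ {Y} (Candidate : Fin n → Set) → (∀ {c} → Candidate c → c ∈ Y) →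
    (∀ {x} → x ∈ Y → Σ (Fin n) λ c → Candidate c × Reach Y c x) →
    ∀ {c} → Candidate c → GoodSource Y Candidate
  goodSource {Y} Candidate candidate⇒∈ covered c-candidate =
    improve c-candidate (reachSet (candidate⇒∈ c-candidate)) (⊃-wellFounded _)
    where
    improve : ∀ {c} → Candidate c → (R : ReachSet Y c) → Acc _⊃_ (members R) → GoodSource Y Candidate
    improve {c} c-candidate R (acc larger) with crossing? (Y ─ members R) (members R)
    ... | no ¬crossing = record
      { source = c ; candidate = c-candidate ; reachSetOf = R ; backward-closed = closed }
      where
      closed : BackwardClosed Y (members R)
      closed {x} {y} x∈Y y∈R x→y with x ∈? members R
      ... | yes x∈R = x∈R
      ... | no x∉R  = contradiction (x , y , x∈p∧x∉q⇒x∈p─q x∈Y x∉R , y∈R , x→y) ¬crossing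
    ... | yes (x , y , x∈Y─R , y∈R , x→y) = improve c′-candidate R′ (larger R⊂R′)
      where
      x∈Y = proj₁ (x∈p─q⁻ Y (members R) x∈Y─R)
      x∉R = proj₂ (x∈p─q⁻ Y (members R) x∈Y─R)
      x→c = edge-to-source (forward-closed R) x∈Y x∉R (source∈ R) (reachable R y∈R) x→y
      c′-candidate = proj₁ (proj₂ (covered x∈Y))
      c′⇝x = proj₂ (proj₂ (covered x∈Y))
      R′ = reachSet (candidate⇒∈ c′-candidate)
      R⊂R′ : members R ⊂ members R′
      R⊂R′ = (λ v∈R → reach⇒member R′ (reach-++ c′⇝x (step x→c (candidate⇒∈ c-candidate)
                                                                (reachable R v∈R))))
           , x , reach⇒member R′ c′⇝x , x∉R

  uwalk-closed : ∀ {S u v} → ForwardClosed ⊤ S → BackwardClosed ⊤ S → u ∈ S → UWalk H u v → v ∈ S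
  uwalk-closed fwd bwd u∈S here                  = u∈S
  uwalk-closed fwd bwd u∈S (step (inj₁ u→w) p) = uwalk-closed fwd bwd (fwd u∈S ∈⊤ u→w) p
  uwalk-closed fwd bwd u∈S (step (inj₂ w→u) p) = uwalk-closed fwd bwd (bwd ∈⊤ u∈S w→u) p

  root : Connected H → Σ (Fin n) λ r → ∀ v → Reach ⊤ r v
  root (n>0 , connected) = source , λ v →
    R.reachable (uwalk-closed R.forward-closed backward-closed R.source∈ (connected source v))
    where
    open GoodSource (goodSource (_∈ ⊤) id (λ {x} x∈⊤ → x , x∈⊤ , here) (∈⊤ {x = fromℕ< n>0}))
    module R = ReachSet reachSetOf

  record VineTree (X : Subset n) (r : Fin n) : Set where
    field
      parent       : Fin n → Fin n
      depth        : Fin n → ℕ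
      depth-root   : depth r ≡ 0
      parent-∈     : ∀ {v} → v ∈ X → v ≢ r → parent v ∈ X
      parent-edge  : ∀ {v} → v ∈ X → v ≢ r → Edge H (parent v) v
      depth-parent : ∀ {v} → v ∈ X → v ≢ r → depth v ≡ suc (depth (parent v))
      comparable   : ∀ {a b} → a ∈ X → b ∈ X → Edge H a b →
                     Ancestor parent r a b ⊎ Ancestor parent r b a

    rooted : ∀ {v} → v ∈ X → Ancestor parent r r v
    rooted v∈X = climb _ refl v∈X
      where
      climb : ∀ k {v} → depth v ≡ k → v ∈ X → Ancestor parent r r v
      climb k {v} depth≡k v∈X with v ≟ r
      ... | yes refl = here
      climb zero    depth≡k v∈X | no v≢r =
        contradiction (trans (sym depth≡k) (depth-parent v∈X v≢r)) 0≢1+n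
      climb (suc k) depth≡k v∈X | no v≢r =
        step v≢r (climb k (suc-injective (trans (sym (depth-parent v∈X v≢r)) depth≡k))
                          (parent-∈ v∈X v≢r))

  singletonTree : ∀ {X r} → (∀ {v} → v ∈ X → v ≡ r) → VineTree X r
  singletonTree only-r = record
    { parent       = id
    ; depth        = λ _ → 0
    ; depth-root   = refl
    ; parent-∈     = λ v∈X v≢r → contradiction (only-r v∈X) v≢r
    ; parent-edge  = λ v∈X v≢r → contradiction (only-r v∈X) v≢r
    ; depth-parent = λ v∈X v≢r → contradiction (only-r v∈X) v≢r
    ; comparable   = λ a∈X b∈X a→b →
                       contradiction (trans (only-r a∈X) (sym (only-r b∈X))) (edge-irreflexive a→b)
    }

  module Graft {X P r c} (r∈X : r ∈ X) (r→c : Edge H r c) (c∈P : c ∈ P) (P⊆X-r : P ⊆ X - r)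
    (forward : ForwardClosed (X - r) P) (backward : BackwardClosed (X - r) P)
    (TP : VineTree P c) (TQ : VineTree (X ─ P) r) where

    private
      module TP = VineTree TP
      module TQ = VineTree TQ

    ∈P⇒∈X : ∀ {v} → v ∈ P → v ∈ X
    ∈P⇒∈X = proj₁ ∘ x∈p-y⁻ X r ∘ P⊆X-r

    ∈P⇒≢r : ∀ {v} → v ∈ P → v ≢ r
    ∈P⇒≢r = proj₂ ∘ x∈p-y⁻ X r ∘ P⊆X-r

    ∈Q⇒∈X : ∀ {v} → v ∈ X ─ P → v ∈ X
    ∈Q⇒∈X = proj₁ ∘ x∈p─q⁻ X P

    ∈Q⇒∉P : ∀ {v} → v ∈ X ─ P → v ∉ P
    ∈Q⇒∉P = proj₂ ∘ x∈p─q⁻ X P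

    r∉P : r ∉ P
    r∉P r∈P = ∈P⇒≢r r∈P refl

    parent : Fin n → Fin n
    parent v with v ∈? P | v ≟ c
    ... | yes _ | yes _ = r
    ... | yes _ | no _  = TP.parent v
    ... | no _  | _     = TQ.parent v

    depth : Fin n → ℕ
    depth v with v ∈? P
    ... | yes _ = suc (TP.depth v)
    ... | no _  = TQ.depth v

    parent-source : parent c ≡ r
    parent-source with c ∈? P | c ≟ c
    ... | yes _  | yes _  = refl
    ... | yes _  | no c≢c = contradiction refl c≢c
    ... | no c∉P | _      = contradiction c∈P c∉P

    parent-P : ∀ {v} → v ∈ P → v ≢ c → parent v ≡ TP.parent v
    parent-P {v} v∈P v≢c with v ∈? P | v ≟ c
    ... | yes _  | no _    = refl
    ... | yes _  | yes v≡c = contradiction v≡c v≢c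
    ... | no v∉P | _       = contradiction v∈P v∉P

    parent-Q : ∀ {v} → v ∉ P → parent v ≡ TQ.parent v
    parent-Q {v} v∉P with v ∈? P | v ≟ c
    ... | yes v∈P | _ = contradiction v∈P v∉P
    ... | no _    | _ = refl

    depth-P : ∀ {v} → v ∈ P → depth v ≡ suc (TP.depth v)
    depth-P {v} v∈P with v ∈? P
    ... | yes _  = refl
    ... | no v∉P = contradiction v∈P v∉P

    depth-Q : ∀ {v} → v ∉ P → depth v ≡ TQ.depth v
    depth-Q {v} v∉P with v ∈? P
    ... | yes v∈P = contradiction v∈P v∉P
    ... | no _    = refl

    parent-step : ∀ {v} → v ∈ X → v ≢ r →
      parent v ∈ X × Edge H (parent v) v × depth v ≡ suc (depth (parent v))
    parent-step {v} v∈X v≢r with v ∈? P | v ≟ c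
    ... | yes _ | yes refl =
      r∈X , r→c , cong suc (trans TP.depth-root (sym (trans (depth-Q r∉P) TQ.depth-root)))
    ... | yes v∈P | no v≢c =
      ∈P⇒∈X p∈P , TP.parent-edge v∈P v≢c ,
      cong suc (trans (TP.depth-parent v∈P v≢c) (sym (depth-P p∈P)))
      where p∈P = TP.parent-∈ v∈P v≢c
    ... | no v∉P | _ =
      ∈Q⇒∈X p∈Q , TQ.parent-edge v∈Q v≢r ,
      trans (TQ.depth-parent v∈Q v≢r) (cong suc (sym (depth-Q (∈Q⇒∉P p∈Q))))
      where v∈Q = x∈p∧x∉q⇒x∈p─q v∈X v∉P
            p∈Q = TQ.parent-∈ v∈Q v≢r

    lift-P : ∀ {u v} → v ∈ P → Ancestor TP.parent c u v → Ancestor parent r u v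
    lift-P = ancestor-map λ w∈P w≢c → ∈P⇒≢r w∈P , parent-P w∈P w≢c , TP.parent-∈ w∈P w≢c

    lift-Q : ∀ {u v} → v ∈ X ─ P → Ancestor TQ.parent r u v → Ancestor parent r u v
    lift-Q = ancestor-map λ w∈Q w≢r → w≢r , parent-Q (∈Q⇒∉P w∈Q) , TQ.parent-∈ w∈Q w≢r

    root-above-P : ∀ {v} → v ∈ P → Ancestor parent r r v
    root-above-P v∈P =
      ancestor-trans (step (∈P⇒≢r c∈P) (subst (Ancestor parent r r) (sym parent-source) here))
                     (lift-P v∈P (TP.rooted v∈P))

    -- Edges between P and its complement have the root r as an endpoint, by the two closure properties.
    comparable : ∀ {a b} → a ∈ X → b ∈ X → Edge H a b →
                 Ancestor parent r a b ⊎ Ancestor parent r b a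
    comparable {a} {b} a∈X b∈X a→b with a ∈? P | b ∈? P
    ... | yes a∈P | yes b∈P = Sum.map (lift-P b∈P) (lift-P a∈P) (TP.comparable a∈P b∈P a→b)
    ... | no a∉P  | no b∉P  = Sum.map (lift-Q b∈Q) (lift-Q a∈Q) (TQ.comparable a∈Q b∈Q a→b)
      where a∈Q = x∈p∧x∉q⇒x∈p─q a∈X a∉P
            b∈Q = x∈p∧x∉q⇒x∈p─q b∈X b∉P
    ... | yes a∈P | no b∉P with b ≟ r
    ...   | yes refl = inj₂ (root-above-P a∈P)
    ...   | no b≢r   = contradiction (forward a∈P (x∈p∧x≢y⇒x∈p-y b∈X b≢r) a→b) b∉P
    comparable {a} a∈X b∈X a→b | no a∉P | yes b∈P with a ≟ r
    ...   | yes refl = inj₁ (root-above-P b∈P)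
    ...   | no a≢r   = contradiction (backward (x∈p∧x≢y⇒x∈p-y a∈X a≢r) b∈P a→b) a∉P

    tree : VineTree X r
    tree = record
      { parent       = parent
      ; depth        = depth
      ; depth-root   = trans (depth-Q r∉P) TQ.depth-root
      ; parent-∈     = λ v∈X v≢r → proj₁ (parent-step v∈X v≢r)
      ; parent-edge  = λ v∈X v≢r → proj₁ (proj₂ (parent-step v∈X v≢r))
      ; depth-parent = λ v∈X v≢r → proj₂ (proj₂ (parent-step v∈X v≢r))
      ; comparable   = comparable
      }

  vineTree : ∀ {X r} → Acc _⊂_ X → r ∈ X → (∀ {v} → v ∈ X → Reach X r v) → VineTree X r
  vineTree {X} {r} (acc smaller) r∈X reach with nonempty? (X - r)
  ... | no X-r-empty = singletonTree λ {v} v∈X →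
        decidable-stable (v ≟ r) λ v≢r → X-r-empty (v , x∈p∧x≢y⇒x∈p-y v∈X v≢r)
  ... | yes (v₀ , v₀∈X-r) =
        Graft.tree r∈X (proj₁ candidate) R.source∈ R.members⊆Y R.forward-closed backward-closed
          (vineTree (smaller P⊂X) R.source∈ (reach-inside R.forward-closed R.source∈ ∘ R.reachable))
          (vineTree (smaller Q⊂X) r∈Q reach-Q)
    where
    Candidate : Fin n → Set
    Candidate c = Edge H r c × c ∈ X - r

    covered : ∀ {x} → x ∈ X - r → Σ (Fin n) λ c → Candidate c × Reach (X - r) c x
    covered x∈X-r with x∈p-y⁻ X r x∈X-r
    ... | x∈X , x≢r = out-neighbour-reaching (reach x∈X) (≢-sym x≢r)

    open GoodSource (goodSource Candidate proj₂ covered (proj₁ (proj₂ (covered v₀∈X-r))))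
    module R = ReachSet reachSetOf
    P = R.members

    P⊆X : P ⊆ X
    P⊆X = proj₁ ∘ x∈p-y⁻ X r ∘ R.members⊆Y

    r∉P : r ∉ P
    r∉P r∈P = proj₂ (x∈p-y⁻ X r (R.members⊆Y r∈P)) refl

    P⊂X : P ⊂ X
    P⊂X = P⊆X , r , r∈X , r∉P

    Q⊂X : X ─ P ⊂ X
    Q⊂X = p─q⊆p X P , source , P⊆X R.source∈ , λ c∈Q → proj₂ (x∈p─q⁻ X P c∈Q) R.source∈

    r∈Q : r ∈ X ─ P
    r∈Q = x∈p∧x∉q⇒x∈p─q r∈X r∉P

    X-r─P⊆Q : X - r ─ P ⊆ X ─ P
    X-r─P⊆Q w∈ with x∈p─q⁻ (X - r) P w∈
    ... | w∈X-r , w∉P = x∈p∧x∉q⇒x∈p─q (proj₁ (x∈p-y⁻ X r w∈X-r)) w∉P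

    reach-Q : ∀ {v} → v ∈ X ─ P → Reach (X ─ P) r v
    reach-Q v∈Q with x∈p─q⁻ X P v∈Q
    ... | v∈X , v∉P =
      reach-mono X-r─P⊆Q (reach-outside R.forward-closed v∉P (reach-avoiding-source (reach v∈X)))

  vineyard : 0 < n → ∀ {r} → VineTree ⊤ r →
    Σ (Digraph n) λ T → Outbranching T × (T ⊆ᴳ H) × Vineyard H T
  vineyard n>0 {r} T = graph , T-outbranching , T⊆H , T-outbranching , T⊆H , comparable-paths
    where
    open VineTree T
    open ParentGraph r parent depth (depth-parent ∈⊤)

    T-outbranching : Outbranching graph
    T-outbranching = outbranching n>0 λ _ → rooted ∈⊤

    T⊆H : graph ⊆ᴳ H
    T⊆H u v u→v with edge⇒treeEdge u→v
    ... | v≢r , refl = parent-edge ∈⊤ v≢r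

    comparable-paths : ∀ a b → Edge H a b → DPath graph a b ⊎ DPath graph b a
    comparable-paths a b a→b =
      Sum.map (λ a≤b → ancestor⇒path a≤b here) (λ b≤a → ancestor⇒path b≤a here) (comparable ∈⊤ ∈⊤ a→b)

lemma5 : (n : ℕ) (H : Digraph n) → Connected H → Elder H →
    Σ (Digraph n) λ T → Outbranching T × (T ⊆ᴳ H) × Vineyard H T
lemma5 n H connected elder =
  vineyard (proj₁ connected) (vineTree (⊂-wellFounded ⊤) ∈⊤ λ {v} _ → proj₂ (root connected) v)
  where open ElderGraph H elder
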